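{- Let $S$ be a regularly linearly ordered monoid, let $A$ be a regular $S$-polygon, let $B$ be a subpolygon of $A$, and let $a_1,\dots,a_k\in A$. Then for every $i$, $1\leq i\leq k$: (1) $\bigcap\{Sa_j\mid 1\le j\le k,\ Sa_j\cap Sa_i\neq\emptyset\}\neq\emptyset$; (2) if $Sa_i\cap B\neq\emptyset$, then $B\cap\bigcap\{Sa_j\mid 1\le j\le k,\ Sa_j\cap Sa_i\neq\emptyset\}\neq\emptyset$.
   Context: Let $S$ be a monoid. A (left) $S$-polygon is a set $A$ with an action $S\times A\to A$ satisfying $s_1(s_2a)=(s_1s_2)a$ and $1a=a$; a subpolygon is a subset closed under the action. For $a\in A$, $Sa=\{sa\mid s\in S\}$. An element $a\in A$ is act-regular if there is a polygon homomorphism $\varphi:Sa\to S$ (with $S$ acting on itself by left multiplication) with $\varphi(a)a=a$; $A$ is regular if all its elements are act-regular. The regular core $R$ of $S$ is the set of $a\in S$ such that $Sa$ is a regular polygon (assumed nonempty). $S$ is regularly linearly ordered if for every $a\in R$ the set $\{Sb\mid b\in S,\ Sb\subseteq Sa\}$ is linearly ordered by inclusion. -}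

module Defs where

open import Level using (0ℓ)
open import Data.Product using (Σ; ∃; _×_; _,_)
open import Data.Sum using (_⊎_)
open import Data.Fin using (Fin)
open import Relation.Nullary using (¬_)
open import Relation.Binary.PropositionalEquality using (_≡_)
open import Algebra.Structures using (IsMonoid)

record Monoid' : Set₁ where
  field
    Carrier  : Set
    _∙_      : Carrier → Carrier → Carrier
    ε        : Carrier
    isMonoid : IsMonoid _≡_ _∙_ ε

record Polygon (S : Monoid') : Set₁ where
  open Monoid' S renaming (Carrier to M)
  field
    Elt    : Set
    _·_    : M → Elt → Elt
    act-assoc : ∀ s₁ s₂ a → s₁ · (s₂ · a) ≡ (s₁ ∙ s₂) · a
    act-unit  : ∀ a → ε · a ≡ a

module _ {S : Monoid'} where
  open Monoid' S renaming (Carrier to M)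

  selfPolygon : Polygon S
  selfPolygon = record
    { Elt = M ; _·_ = _∙_
    ; act-assoc = λ s₁ s₂ a → Eq.sym (assoc s₁ s₂ a)
    ; act-unit = identityˡ }
    where
      open IsMonoid isMonoid using (assoc; identityˡ)
      import Relation.Binary.PropositionalEquality as Eq

module _ {S : Monoid'} (A : Polygon S) where
  open Monoid' S renaming (Carrier to M)
  open Polygon A

  IsSubpolygon : (Elt → Set) → Set
  IsSubpolygon B = ∀ s x → B x → B (s · x)

  -- the cyclic subpolygon Sa, as a predicate on A
  _∈S_ : Elt → Elt → Set
  x ∈S a = ∃ λ s → s · a ≡ x

  -- a polygon homomorphism φ : Sa → S, given on elements of Sa
  -- (well defined: independent of the membership witness)
  record HomCyclic (a : Elt) : Set where
    field
      φ           : (x : Elt) → x ∈S a → M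
      well-def    : ∀ x (p q : x ∈S a) → φ x p ≡ φ x q
      equivariant : ∀ s x (p : x ∈S a) (q : (s · x) ∈S a) → φ (s · x) q ≡ s ∙ φ x p

  self∈S : (a : Elt) → a ∈S a
  self∈S a = ε , act-unit a

  ActRegular : Elt → Set
  ActRegular a = Σ (HomCyclic a) λ h → HomCyclic.φ h a (self∈S a) · a ≡ a

  RegularPolygon : Set
  RegularPolygon = ∀ a → ActRegular a

module _ (S : Monoid') where
  open Monoid' S renaming (Carrier to M)

  -- a ∈ R : the cyclic subpolygon Sa of S is regular, i.e. every element of Sa
  -- is act-regular (act-regularity of x only involves Sx ⊆ Sa).
  InRegularCore : M → Set
  InRegularCore a = ∀ x → _∈S_ (selfPolygon {S}) x a → ActRegular (selfPolygon {S}) x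

  _⊆S_ : M → M → Set
  b ⊆S c = ∀ x → _∈S_ (selfPolygon {S}) x b → _∈S_ (selfPolygon {S}) x c

  RegularlyLinearlyOrdered : Set
  RegularlyLinearlyOrdered =
    ∀ a → InRegularCore a → ∀ b c → b ⊆S a → c ⊆S a → (b ⊆S c) ⊎ (c ⊆S b)

NonEmpty : {X : Set} → (X → Set) → Set
NonEmpty {X} P = ¬ (∀ x → ¬ P x)

module Submission where

-- Fix a ∈ A with φ : Sa → S and φ(a)a = a, and put e = φ(a). Then
-- e is idempotent and w ↦ wa maps Se bijectively onto Sa (its inverse is φ), so
-- regularity of A makes every element of Se act-regular: e lies in the regular
-- core. As S is regularly linearly ordered, the left ideals inside Se form a
-- chain, and transporting along w ↦ wa the cyclic subpolygons inside Sa form a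
-- chain as well. Now pick, for every j with Saⱼ ∩ Saᵢ ≠ ∅, a point of that
-- intersection (possible only under double negation): the least of these
-- points together with aᵢ (or with a given b ∈ B ∩ Saᵢ) lies in every such Saⱼ.

open import Defs
open import Level using (0ℓ)
open import Data.Nat using (ℕ)
open import Data.Fin using (Fin)
open import Data.Product using (Σ; ∃; _×_; _,_)
open import Data.Sum as Sum using (_⊎_; inj₁; inj₂)
open import Data.Empty using (⊥-elim)
open import Data.List using (List; []; _∷_; allFin)
open import Data.List.Relation.Unary.All as All using (All; []; _∷_)
open import Data.List.Membership.Propositional.Properties using (∈-allFin)
open import Function using (_∘_)
open import Relation.Binary using (Rel; Reflexive; Transitive)
open import Relation.Binary.PropositionalEquality
open import Relation.Nullary using (yes; no)
open import Relation.Nullary.Decidable using (¬¬-excluded-middle)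
open import Relation.Nullary.Negation
  using (DoubleNegation; ¬¬-Monad; contraposition; ¬∃⟶∀¬; ∀¬⟶¬∃)
open import Relation.Unary using (Pred)
open import Algebra.Structures using (IsMonoid)
open import Effect.Monad using (RawMonad)

open RawMonad (¬¬-Monad {0ℓ}) using (pure; _>>=_)

nonEmpty⇒¬¬∃ : {X : Set} {P : X → Set} → NonEmpty P → DoubleNegation (∃ P)
nonEmpty⇒¬¬∃ = contraposition ¬∃⟶∀¬

¬¬∃⇒nonEmpty : {X : Set} {P : X → Set} → DoubleNegation (∃ P) → NonEmpty P
¬¬∃⇒nonEmpty = contraposition ∀¬⟶¬∃

module _ {X : Set} (_≼_ : Rel X 0ℓ) (≼-refl : Reflexive _≼_) (≼-trans : Transitive _≼_)
         {c : X} (≼-total-below : ∀ {x y} → x ≼ c → y ≼ c → x ≼ y ⊎ y ≼ x) where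

  common-lower-bound : {J : Set} {Q : J → Pred X 0ℓ} → (∀ j {x y} → x ≼ y → Q j y → Q j x)
    → ∀ {x₀} → x₀ ≼ c → (js : List J) → All (λ j → ∃ λ y → y ≼ c × Q j y) js
    → ∃ λ x → x ≼ x₀ × All (λ j → Q j x) js
  common-lower-bound Q-down {x₀} x₀≼c [] [] = x₀ , ≼-refl , []
  common-lower-bound Q-down x₀≼c (j ∷ js) ((y , y≼c , Qy) ∷ witnesses)
    with common-lower-bound Q-down x₀≼c js witnesses
  ... | x , x≼x₀ , Qx with ≼-total-below (≼-trans x≼x₀ x₀≼c) y≼c
  ...   | inj₁ x≼y = x , x≼x₀ , Q-down j x≼y Qy ∷ Qx
  ...   | inj₂ y≼x = y , ≼-trans y≼x x≼x₀ , Qy ∷ All.map (λ {k} → Q-down k y≼x) Qx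

module _ {S : Monoid'} (A : Polygon S) where
  open Polygon A

  ∈S-trans : Transitive (_∈S_ A)
  ∈S-trans {k = z} (u , refl) (v , refl) = u ∙ v , sym (act-assoc u v z)
    where open Monoid' S

  φ-cong : ∀ {b} (h : HomCyclic A b) {x y} (p : _∈S_ A x b) (q : _∈S_ A y b) → x ≡ y
         → HomCyclic.φ h x p ≡ HomCyclic.φ h y q
  φ-cong h {x} p q refl = HomCyclic.well-def h x p q

module _ {S : Monoid'} {A C : Polygon S} (f : Polygon.Elt A → Polygon.Elt C)
         (f-equivariant : ∀ s x → f (Polygon._·_ A s x) ≡ Polygon._·_ C s (f x)) where
  open Monoid' S renaming (Carrier to M)
  open Polygon A using (Elt; _·_)
  open Polygon C using () renaming (_·_ to _·ᶜ_)

  ∈S-map : ∀ {x y} → _∈S_ A x y → _∈S_ C (f x) (f y)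
  ∈S-map {y = y} (s , refl) = s , sym (f-equivariant s y)

  act-regular-reflect : ∀ {x} → (∀ {u v} → _∈S_ A u x → _∈S_ A v x → f u ≡ f v → u ≡ v)
    → ActRegular C (f x) → ActRegular A x
  act-regular-reflect {x} f-injective (h , h-regular) = ψ , ψ-regular
    where
    open HomCyclic h
    ψ : HomCyclic A x
    ψ = record
      { φ = λ w p → φ (f w) (∈S-map p)
      ; well-def = λ w p q → well-def (f w) (∈S-map p) (∈S-map q)
      ; equivariant = λ s w p q →
          trans (φ-cong C h (∈S-map q) (s·fw∈Sfx s p) (f-equivariant s w))
                (equivariant s (f w) (∈S-map p) (s·fw∈Sfx s p)) }
      where
      s·fw∈Sfx : ∀ s {w} → _∈S_ A w x → _∈S_ C (s ·ᶜ f w) (f x)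
      s·fw∈Sfx s p = ∈S-trans C (s , refl) (∈S-map p)
    c : M
    c = HomCyclic.φ ψ x (self∈S A x)
    ψ-regular : c · x ≡ x
    ψ-regular = f-injective (c , refl) (self∈S A x) (begin
      f (c · x)                       ≡⟨ f-equivariant c x ⟩
      c ·ᶜ f x                        ≡⟨ cong (_·ᶜ f x) (well-def (f x) _ (self∈S C (f x))) ⟩
      φ (f x) (self∈S C (f x)) ·ᶜ f x ≡⟨ h-regular ⟩
      f x                             ∎)
      where open ≡-Reasoning

module _ {S : Monoid'} (A : Polygon S) (A-regular : RegularPolygon A) where
  open Monoid' S renaming (Carrier to M)
  open IsMonoid isMonoid using (assoc)
  open Polygon A

  private
    SP : Polygon S
    SP = selfPolygon {S}

  module Orbit (a : Elt) where
    h : HomCyclic A a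
    h = Σ.proj₁ (A-regular a)
    open HomCyclic h

    e : M
    e = φ a (self∈S A a)

    e·a≡a : e · a ≡ a
    e·a≡a = Σ.proj₂ (A-regular a)

    ·a-equivariant : ∀ s w → (s ∙ w) · a ≡ s · (w · a)
    ·a-equivariant s w = sym (act-assoc s w a)

    φ-orbit : ∀ s q → φ (s · a) q ≡ s ∙ e
    φ-orbit s q = equivariant s a (self∈S A a) q

    e-idempotent : e ∙ e ≡ e
    e-idempotent = trans (sym (φ-orbit e (e , refl))) (φ-cong A h _ _ e·a≡a)

    ∙e-· : ∀ s → (s ∙ e) · a ≡ s · a
    ∙e-· s = trans (·a-equivariant s e) (cong (s ·_) e·a≡a)

    φ-retraction : ∀ {u} → _∈S_ SP u e → φ (u · a) (u , refl) ≡ u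
    φ-retraction (t , refl) = trans (φ-orbit (t ∙ e) _) (trans (assoc t e e) (cong (t ∙_) e-idempotent))

    ·a-injective-on-Se : ∀ {u v} → _∈S_ SP u e → _∈S_ SP v e → u · a ≡ v · a → u ≡ v
    ·a-injective-on-Se u∈Se v∈Se ua≡va =
      trans (sym (φ-retraction u∈Se)) (trans (φ-cong A h _ _ ua≡va) (φ-retraction v∈Se))

    e-in-regular-core : InRegularCore S e
    e-in-regular-core x x∈Se =
      act-regular-reflect {A = SP} {C = A} (_· a) ·a-equivariant
        (λ p q → ·a-injective-on-Se (∈S-trans SP p x∈Se) (∈S-trans SP q x∈Se))
        (A-regular (x · a))

    ideal-⊆-Se : ∀ s → _⊆S_ S (s ∙ e) e
    ideal-⊆-Se s w w∈Sse = ∈S-trans SP w∈Sse (s , refl)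

    ∈S-transport : ∀ s t → _∈S_ SP (s ∙ e) (t ∙ e) → _∈S_ A (s · a) (t · a)
    ∈S-transport s t = subst₂ (_∈S_ A) (∙e-· s) (∙e-· t) ∘ ∈S-map {A = SP} {C = A} (_· a) ·a-equivariant

    Sa-linear : RegularlyLinearlyOrdered S
      → ∀ {x y} → _∈S_ A x a → _∈S_ A y a → _∈S_ A x y ⊎ _∈S_ A y x
    Sa-linear S-rlo (s , refl) (t , refl) =
      Sum.map (λ Sse⊆Ste → ∈S-transport s t (Sse⊆Ste (s ∙ e) (self∈S SP (s ∙ e))))
              (λ Ste⊆Sse → ∈S-transport t s (Ste⊆Sse (t ∙ e) (self∈S SP (t ∙ e))))
              (S-rlo e e-in-regular-core (s ∙ e) (t ∙ e) (ideal-⊆-Se s) (ideal-⊆-Se t))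

  module CommonPoint (S-rlo : RegularlyLinearlyOrdered S) {k : ℕ} (a : Fin k → Elt) (i : Fin k) where

    Meets : Fin k → Set
    Meets j = NonEmpty (λ y → _∈S_ A y (a j) × _∈S_ A y (a i))

    meeting-point : ∀ j → DoubleNegation (∃ λ y → _∈S_ A y (a i) × (Meets j → _∈S_ A y (a j)))
    meeting-point j = ¬¬-excluded-middle >>= λ where
      (yes meets) → nonEmpty⇒¬¬∃ meets >>= λ (y , y∈Saⱼ , y∈Saᵢ) → pure (y , y∈Saᵢ , λ _ → y∈Saⱼ)
      (no ¬meets) → pure (a i , self∈S A (a i) , ⊥-elim ∘ ¬meets)

    common-point-below : ∀ {x₀} → _∈S_ A x₀ (a i)
      → DoubleNegation (∃ λ x → _∈S_ A x x₀ × ∀ j → Meets j → _∈S_ A x (a j))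
    common-point-below x₀∈Saᵢ =
      All.sequenceM 0ℓ ¬¬-Monad (All.tabulate {xs = allFin k} (λ {j} _ → meeting-point j)) >>= λ points →
      let x , x∈Sx₀ , x∈Saⱼ = common-lower-bound (_∈S_ A) (self∈S A _) (∈S-trans A) (Orbit.Sa-linear (a i) S-rlo)
                                (λ j x∈Sy y∈Saⱼ meets → ∈S-trans A x∈Sy (y∈Saⱼ meets))
                                x₀∈Saᵢ (allFin k) points
      in pure (x , x∈Sx₀ , All.lookup x∈Saⱼ ∘ ∈-allFin)

lemma5p1 : (S : Monoid') → (∃ λ r → InRegularCore S r) → RegularlyLinearlyOrdered S
    → (A : Polygon S) → RegularPolygon A
    → (B : Polygon.Elt A → Set) → IsSubpolygon A B
    → (k : ℕ) (a : Fin k → Polygon.Elt A) (i : Fin k)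
    → NonEmpty (λ x → ∀ j → NonEmpty (λ y → _∈S_ A y (a j) × _∈S_ A y (a i)) → _∈S_ A x (a j))
      × (NonEmpty (λ y → _∈S_ A y (a i) × B y)
         → NonEmpty (λ x → B x × (∀ j → NonEmpty (λ y → _∈S_ A y (a j) × _∈S_ A y (a i)) → _∈S_ A x (a j))))
lemma5p1 S _ S-rlo A A-regular B B-closed k a i =
    ¬¬∃⇒nonEmpty (common-point-below (self∈S A (a i)) >>= λ (x , _ , x∈Saⱼ) → pure (x , x∈Saⱼ))
  , λ B-meets → ¬¬∃⇒nonEmpty (
      nonEmpty⇒¬¬∃ B-meets >>= λ (b , b∈Saᵢ , b∈B) →
      common-point-below b∈Saᵢ >>= λ where
        (x , (s , refl) , x∈Saⱼ) → pure (x , B-closed s b b∈B , x∈Saⱼ))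
  where open CommonPoint A A-regular S-rlo a i using (common-point-below)
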